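{- Let $l$ be a fixed positive integer. Then for every integer $n\ge1$, $$\left\lfloor\left(\sum_{k=n}^\infty\frac{1}{B_{lk}}\right)^{ -1}\right\rfloor=B_{ln}-B_{l(n-1)}-1\qquad\text{and}\qquad\left\lfloor\left(\sum_{k=n}^\infty\frac{1}{C_{lk}}\right)^{ -1}\right\rfloor=C_{ln}-C_{l(n-1)}.$$
   Context: The balancing numbers are defined by $B_0=0$, $B_1=1$, $B_n=6B_{n-1}-B_{n-2}$ for $n\ge 2$. The Lucas-balancing numbers are defined by $C_0=1$, $C_1=3$, $C_n=6C_{n-1}-C_{n-2}$ for $n\ge 2$. $\lfloor x\rfloor$ denotes the integer part (floor) of a real number $x$. -}

module Defs where

open import Data.Nat as ℕ using (ℕ; zero; suc)
open import Data.Integer as ℤ using (ℤ; +_; -[1+_])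
open import Data.Rational as ℚ using (ℚ; _/_; 0ℚ; 1ℚ)
open import Data.Product using (_×_; ∃-syntax)

B : ℕ → ℤ
B zero = + 0
B (suc zero) = + 1
B (suc (suc n)) = + 6 ℤ.* B (suc n) ℤ.- B n

C : ℕ → ℤ
C zero = + 1
C (suc zero) = + 3
C (suc (suc n)) = + 6 ℤ.* C (suc n) ℤ.- C n

-- Reciprocal 1/z of an integer as a rational (only used for z > 0;
-- the value 0 for z ≤ 0 is an irrelevant convention).
recip : ℤ → ℚ
recip (+ zero) = 0ℚ
recip (+ suc m) = + 1 / suc m
recip -[1+ m ] = 0ℚ

-- partialSum f n N = Σ_{k=n}^{n+N} f k
partialSum : (ℕ → ℚ) → ℕ → ℕ → ℚ
partialSum f n zero = f n
partialSum f n (suc N) = partialSum f n N ℚ.+ f (n ℕ.+ suc N)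

-- FloorInvTail f n m  means  ⌊ (Σ_{k=n}^∞ f k)⁻¹ ⌋ = m, for a series f of
-- positive rationals whose sum S = sup of its partial sums is finite.
-- ⌊1/S⌋ = m  ⇔  m ≤ 1/S < m+1  ⇔  m·S ≤ 1 < (m+1)·S  (S > 0), and
-- with S = sup_N (partial sums): m·S ≤ 1 ⇔ ∀N. m·S_N ≤ 1,
-- and 1 < (m+1)·S ⇔ ∃N. 1 < (m+1)·S_N.
FloorInvTail : (ℕ → ℚ) → ℕ → ℤ → Set
FloorInvTail f n m =
  ((N : ℕ) → (m / 1) ℚ.* partialSum f n N ℚ.≤ 1ℚ)
  × (∃[ N ] (1ℚ ℚ.< ((m ℤ.+ + 1) / 1) ℚ.* partialSum f n N))

{-# OPTIONS --safe #-}
-- Write aₖ = X (l·k) for X = B or C. Both subsequences satisfy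
-- aₖ₊₂ + aₖ = 2 C_l aₖ₊₁, so the differences Dₖ = aₖ₊₁ − aₖ increase to
-- infinity and aₖ₊₁² − aₖ aₖ₊₂ is a constant Δ (B_l² resp. 1 − C_l²).
-- For pₖ = Dₖ + u the reciprocals 1/pₖ telescope against the series:
--   aₖ₊₁ pₖ pₖ₊₁ (1/aₖ₊₁ + 1/pₖ₊₁ − 1/pₖ) = Δ + u (Dₖ + Dₖ₊₁) + u².
-- When this defect is ≤ 0 for all k (u = −1 for B, u = 0 for C) the tail
-- from n is at most 1/pₙ₋₁; when it is ≥ 1 (u = 0 for B, u = 1 for C) the
-- first step leaves a fixed slack that the remainder 1/p_N → 0 cannot
-- absorb, so a partial sum already exceeds 1/pₙ₋₁.
module Submission where

open import Defs
open import Data.Nat as ℕ using (ℕ; zero; suc)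
import Data.Nat.Properties as ℕP
open import Data.Integer as ℤ using (ℤ; +_; -_; _+_; _-_; _*_; _≤_; _<_; ∣_∣; +≤+; +<+)
import Data.Integer.Properties as ℤP
open import Data.Integer.Tactic.RingSolver using (solve-∀)
open import Data.Rational as ℚ using (ℚ; _/_; 0ℚ; 1ℚ; toℚᵘ)
import Data.Rational.Properties as ℚP
import Data.Rational.Unnormalised as ℚᵘ
import Data.Rational.Unnormalised.Properties as ℚᵘP
open import Data.Product using (∃-syntax; _×_; _,_; proj₁; proj₂)
open import Relation.Binary.PropositionalEquality
open import Relation.Nullary using (yes; no)
open import Data.Empty using (⊥-elim)
open import Function using (_∘_)

0≤+ : ∀ n → + 0 ≤ + n
0≤+ n = +≤+ ℕ.z≤n

0≤i*j : ∀ {i j} → + 0 ≤ i → + 0 ≤ j → + 0 ≤ i * j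
0≤i*j {+ m} {+ n} (+≤+ _) (+≤+ _) = subst (+ 0 ≤_) (ℤP.pos-* m n) (0≤+ (m ℕ.* n))

1≤i*j : ∀ {i j} → + 1 ≤ i → + 1 ≤ j → + 1 ≤ i * j
1≤i*j (+≤+ (ℕ.s≤s _)) (+≤+ (ℕ.s≤s _)) = +≤+ (ℕ.s≤s ℕ.z≤n)

≤-via-slack : ∀ {i j e} → + 0 ≤ e → j ≡ i + e → i ≤ j
≤-via-slack {i} {j} {e} 0≤e j≡i+e =
  subst (i ≤_) (sym j≡i+e) (subst (_≤ i + e) (ℤP.+-identityʳ i) (ℤP.+-monoʳ-≤ i 0≤e))

private
  positive : ∀ {x} → + 0 < x → ∃[ a ] x ≡ + suc a
  positive {+ suc a} _ = a , refl
  positive {+ zero} (+<+ ())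

  1/suc : ℕ → ℚᵘ.ℚᵘ
  1/suc a = ℚᵘ.mkℚᵘ (+ 1) a

  toℚᵘ-recip : ∀ a → toℚᵘ (recip (+ suc a)) ℚᵘ.≃ 1/suc a
  toℚᵘ-recip a = ℚP.toℚᵘ-fromℚᵘ (1/suc a)

  toℚᵘ-recip-+ : ∀ a b → toℚᵘ (recip (+ suc a) ℚ.+ recip (+ suc b)) ℚᵘ.≃ 1/suc a ℚᵘ.+ 1/suc b
  toℚᵘ-recip-+ a b = ℚᵘP.≃-trans (ℚP.toℚᵘ-homo-+ (recip (+ suc a)) (recip (+ suc b)))
                                  (ℚᵘP.+-cong (toℚᵘ-recip a) (toℚᵘ-recip b))

  toℚᵘ-fromℤ : ∀ a → toℚᵘ (+ suc a / 1) ℚᵘ.≃ ℚᵘ.mkℚᵘ (+ suc a) 0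
  toℚᵘ-fromℤ a = ℚP.toℚᵘ-fromℚᵘ (ℚᵘ.mkℚᵘ (+ suc a) 0)

recip-nonNeg : ∀ z → 0ℚ ℚ.≤ recip z
recip-nonNeg (+ zero)   = ℚP.≤-refl
recip-nonNeg (+ suc m)  = ℚP.nonNegative⁻¹ (recip (+ suc m)) {{ℚP.normalize-nonNeg 1 (suc m)}}
recip-nonNeg ℤ.-[1+ m ] = ℚP.≤-refl

recip-+-recip-≤-recip : ∀ {x y z} → + 0 < x → + 0 < y → + 0 < z →
                        z * (y + x) ≤ x * y → recip x ℚ.+ recip y ℚ.≤ recip z
recip-+-recip-≤-recip 0<x 0<y 0<z h with positive 0<x | positive 0<y | positive 0<z
... | a , refl | b , refl | c , refl = ℚP.toℚᵘ-cancel-≤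
  (ℚᵘP.≤-respˡ-≃ (ℚᵘP.≃-sym (toℚᵘ-recip-+ a b)) (ℚᵘP.≤-respʳ-≃ (ℚᵘP.≃-sym (toℚᵘ-recip c))
    (ℚᵘ.*≤* (subst₂ _≤_ (lhs (+ suc a) (+ suc b) (+ suc c)) (rhs (+ suc a) (+ suc b)) h))))
  where
  lhs : ∀ x y z → z * (y + x) ≡ (+ 1 * y + + 1 * x) * z
  lhs = solve-∀
  rhs : ∀ x y → x * y ≡ + 1 * (x * y)
  rhs = solve-∀

recip-≤-recip-+-recip : ∀ {x y z} → + 0 < x → + 0 < y → + 0 < z →
                        x * y ≤ z * (y + x) → recip z ℚ.≤ recip x ℚ.+ recip y
recip-≤-recip-+-recip 0<x 0<y 0<z h with positive 0<x | positive 0<y | positive 0<z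
... | a , refl | b , refl | c , refl = ℚP.toℚᵘ-cancel-≤
  (ℚᵘP.≤-respʳ-≃ (ℚᵘP.≃-sym (toℚᵘ-recip-+ a b)) (ℚᵘP.≤-respˡ-≃ (ℚᵘP.≃-sym (toℚᵘ-recip c))
    (ℚᵘ.*≤* (subst₂ _≤_ (lhs (+ suc a) (+ suc b)) (rhs (+ suc a) (+ suc b) (+ suc c)) h))))
  where
  lhs : ∀ x y → x * y ≡ + 1 * (x * y)
  lhs = solve-∀
  rhs : ∀ x y z → z * (y + x) ≡ (+ 1 * y + + 1 * x) * z
  rhs = solve-∀

private
  recip-+-recip-≤-recip-+-recip : ∀ {x y z w} → + 0 < x → + 0 < y → + 0 < z → + 0 < w →
    (w + z) * (x * y) ≤ (y + x) * (z * w) → recip z ℚ.+ recip w ℚ.≤ recip x ℚ.+ recip y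
  recip-+-recip-≤-recip-+-recip 0<x 0<y 0<z 0<w h
    with positive 0<x | positive 0<y | positive 0<z | positive 0<w
  ... | a , refl | b , refl | c , refl | d , refl = ℚP.toℚᵘ-cancel-≤
    (ℚᵘP.≤-respʳ-≃ (ℚᵘP.≃-sym (toℚᵘ-recip-+ a b)) (ℚᵘP.≤-respˡ-≃ (ℚᵘP.≃-sym (toℚᵘ-recip-+ c d))
      (ℚᵘ.*≤* (subst₂ _≤_ (lhs (+ suc a) (+ suc b) (+ suc c) (+ suc d))
                          (rhs (+ suc a) (+ suc b) (+ suc c) (+ suc d)) h))))
    where
    lhs : ∀ x y z w → (w + z) * (x * y) ≡ (+ 1 * w + + 1 * z) * (x * y)
    lhs = solve-∀
    rhs : ∀ x y z w → (y + x) * (z * w) ≡ (+ 1 * y + + 1 * x) * (z * w)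
    rhs = solve-∀

-- 1/x + 1/y − 1/z = (z (y + x) − x y) / (x y z), so a defect of at least 1
-- is a gain of at least 1/(x y z).
recip-+-recip-xyz-≤-recip-+-recip : ∀ {x y z} → + 0 < x → + 0 < y → + 0 < z →
  + 1 ≤ z * (y + x) - x * y → recip z ℚ.+ recip (x * y * z) ℚ.≤ recip x ℚ.+ recip y
recip-+-recip-xyz-≤-recip-+-recip {x} {y} {z} 0<x 0<y 0<z 1≤d =
  recip-+-recip-≤-recip-+-recip 0<x 0<y 0<z (ℤP.suc[i]≤j⇒i<j 1≤xyz)
    (≤-via-slack (0≤i*j (ℤP.≤-trans (0≤+ 1) 1≤xyz) (ℤP.i≤j⇒0≤j-i 1≤d)) (slack x y z))
  where
  1≤xyz : + 1 ≤ x * y * z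
  1≤xyz = 1≤i*j (1≤i*j (ℤP.i<j⇒suc[i]≤j 0<x) (ℤP.i<j⇒suc[i]≤j 0<y)) (ℤP.i<j⇒suc[i]≤j 0<z)
  slack : ∀ x y z → (y + x) * (z * (x * y * z))
                  ≡ (x * y * z + z) * (x * y) + x * y * z * (z * (y + x) - x * y - + 1)
  slack = solve-∀

recip-antitone-< : ∀ {x y} → + 0 < y → y < x → recip x ℚ.< recip y
recip-antitone-< 0<y y<x with positive (ℤP.<-trans 0<y y<x) | positive 0<y
... | a , refl | b , refl = ℚP.toℚᵘ-cancel-<
  (ℚᵘP.<-respˡ-≃ (ℚᵘP.≃-sym (toℚᵘ-recip a)) (ℚᵘP.<-respʳ-≃ (ℚᵘP.≃-sym (toℚᵘ-recip b))
    (ℚᵘ.*<* (subst₂ _<_ (sym (ℤP.*-identityˡ (+ suc b))) (sym (ℤP.*-identityˡ (+ suc a))) y<x))))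

≤-recip⇒*≤1 : ∀ {z} (S : ℚ) → + 0 < z → S ℚ.≤ recip z → (z / 1) ℚ.* S ℚ.≤ 1ℚ
≤-recip⇒*≤1 S 0<z S≤1/z with positive 0<z
... | a , refl = ℚP.toℚᵘ-cancel-≤
  (ℚᵘP.≤-respˡ-≃ (ℚᵘP.≃-sym (ℚᵘP.≃-trans (ℚP.toℚᵘ-homo-* (+ suc a / 1) S) (ℚᵘP.*-congʳ (toℚᵘ-fromℤ a))))
    (cross-multiply (toℚᵘ S) (ℚᵘP.≤-respʳ-≃ (toℚᵘ-recip a) (ℚP.toℚᵘ-mono-≤ S≤1/z))))
  where
  cross-multiply : ∀ s → s ℚᵘ.≤ 1/suc a → ℚᵘ.mkℚᵘ (+ suc a) 0 ℚᵘ.* s ℚᵘ.≤ ℚᵘ.mkℚᵘ (+ 1) 0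
  cross-multiply (ℚᵘ.mkℚᵘ n d) (ℚᵘ.*≤* h) = ℚᵘ.*≤*
    (ℤP.≤-trans (ℤP.≤-reflexive (trans (ℤP.*-identityʳ _) (ℤP.*-comm (+ suc a) n)))
      (ℤP.≤-trans h (ℤP.≤-reflexive (sym (ℤP.*-identityˡ _)))))

recip<⇒1<* : ∀ {z} (S : ℚ) → + 0 < z → recip z ℚ.< S → 1ℚ ℚ.< (z / 1) ℚ.* S
recip<⇒1<* S 0<z 1/z<S with positive 0<z
... | a , refl = ℚP.toℚᵘ-cancel-<
  (ℚᵘP.<-respʳ-≃ (ℚᵘP.≃-sym (ℚᵘP.≃-trans (ℚP.toℚᵘ-homo-* (+ suc a / 1) S) (ℚᵘP.*-congʳ (toℚᵘ-fromℤ a))))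
    (cross-multiply (toℚᵘ S) (ℚᵘP.<-respˡ-≃ (toℚᵘ-recip a) (ℚP.toℚᵘ-mono-< 1/z<S))))
  where
  cross-multiply : ∀ s → 1/suc a ℚᵘ.< s → ℚᵘ.mkℚᵘ (+ 1) 0 ℚᵘ.< ℚᵘ.mkℚᵘ (+ suc a) 0 ℚᵘ.* s
  cross-multiply (ℚᵘ.mkℚᵘ n d) (ℚᵘ.*<* h) = ℚᵘ.*<*
    (ℤP.≤-<-trans (ℤP.≤-reflexive (ℤP.*-identityˡ _))
      (ℤP.<-≤-trans h (ℤP.≤-reflexive (trans (ℤP.*-comm n (+ suc a)) (sym (ℤP.*-identityʳ _))))))

+-cancelʳ-< : ∀ r {p q} → p ℚ.+ r ℚ.< q ℚ.+ r → p ℚ.< q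
+-cancelʳ-< r {p} {q} p+r<q+r with q ℚP.≤? p
... | yes q≤p = ⊥-elim (ℚP.<-irrefl refl (ℚP.<-≤-trans p+r<q+r (ℚP.+-monoˡ-≤ r q≤p)))
... | no q≰p = ℚP.≰⇒> q≰p

module _ (f : ℕ → ℚ) (n : ℕ) (t : ℕ → ℚ) where
  open ℚP.≤-Reasoning

  telescope-≤ : ∀ {s} → f n ℚ.+ t 1 ℚ.≤ s →
    (∀ j → f (n ℕ.+ suc j) ℚ.+ t (suc (suc j)) ℚ.≤ t (suc j)) →
    ∀ N → partialSum f n N ℚ.+ t (suc N) ℚ.≤ s
  telescope-≤ base step zero = base
  telescope-≤ {s} base step (suc N) = begin
    partialSum f n N ℚ.+ f (n ℕ.+ suc N) ℚ.+ t (suc (suc N))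
      ≡⟨ ℚP.+-assoc (partialSum f n N) (f (n ℕ.+ suc N)) (t (suc (suc N))) ⟩
    partialSum f n N ℚ.+ (f (n ℕ.+ suc N) ℚ.+ t (suc (suc N)))
      ≤⟨ ℚP.+-monoʳ-≤ (partialSum f n N) (step N) ⟩
    partialSum f n N ℚ.+ t (suc N)
      ≤⟨ telescope-≤ base step N ⟩
    s ∎

  telescope-≥ : ∀ {s} → s ℚ.≤ f n ℚ.+ t 1 →
    (∀ j → t (suc j) ℚ.≤ f (n ℕ.+ suc j) ℚ.+ t (suc (suc j))) →
    ∀ N → s ℚ.≤ partialSum f n N ℚ.+ t (suc N)
  telescope-≥ base step zero = base
  telescope-≥ {s} base step (suc N) = begin
    s
      ≤⟨ telescope-≥ base step N ⟩
    partialSum f n N ℚ.+ t (suc N)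
      ≤⟨ ℚP.+-monoʳ-≤ (partialSum f n N) (step N) ⟩
    partialSum f n N ℚ.+ (f (n ℕ.+ suc N) ℚ.+ t (suc (suc N)))
      ≡⟨ ℚP.+-assoc (partialSum f n N) (f (n ℕ.+ suc N)) (t (suc (suc N))) ⟨
    partialSum f n N ℚ.+ f (n ℕ.+ suc N) ℚ.+ t (suc (suc N)) ∎

-- Sequences with aₖ₊₂ + aₖ = 2c aₖ₊₁

-- x, y, z are consecutive terms and p = y − x + u, p′ = z − y + u; then
-- defect x y z u = y p p′ (1/y + 1/p′ − 1/p).
defect : ℤ → ℤ → ℤ → ℤ → ℤ
defect x y z u = (y - x + u) * ((z - y + u) + y) - y * (z - y + u)

module SecondOrder (a : ℕ → ℤ) (c : ℤ) (2≤c : + 2 ≤ c)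
                   (a-rec : ∀ k → a (suc (suc k)) + a k ≡ + 2 * c * a (suc k))
                   (0≤a₀ : + 0 ≤ a 0) (1≤D₀ : + 1 ≤ a 1 - a 0) where

  D : ℕ → ℤ
  D k = a (suc k) - a k

  a-rec′ : ∀ k → a (suc (suc k)) ≡ + 2 * c * a (suc k) - a k
  a-rec′ k = trans (add-sub (a (suc (suc k))) (a k)) (cong (_- a k) (a-rec k))
    where
    add-sub : ∀ x y → x ≡ (x + y) - y
    add-sub = solve-∀

  D-suc : ∀ k → D (suc k) ≡ D k + + 2 * (c - + 1) * a (suc k)
  D-suc k = trans (cong (_- a (suc k)) (a-rec′ k)) (rearrange (a k) (a (suc k)) c)
    where
    rearrange : ∀ x y c → (+ 2 * c * y - x) - y ≡ (y - x) + + 2 * (c - + 1) * y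
    rearrange = solve-∀

  D-increasing-from : ∀ {k} → + 1 ≤ a (suc k) → D k < D (suc k)
  D-increasing-from {k} 1≤y = ℤP.suc[i]≤j⇒i<j (≤-via-slack 0≤slack (trans (D-suc k) (slack (D k) y c)))
    where
    y : ℤ
    y = a (suc k)
    0≤y : + 0 ≤ y
    0≤y = ℤP.≤-trans (0≤+ 1) 1≤y
    0≤slack : + 0 ≤ (c - + 2) * (+ 2 * y) + (y - + 1) + y
    0≤slack = ℤP.+-mono-≤ (ℤP.+-mono-≤ (0≤i*j (ℤP.i≤j⇒0≤j-i 2≤c) (0≤i*j (0≤+ 2) 0≤y))
                                       (ℤP.i≤j⇒0≤j-i 1≤y)) 0≤y
    slack : ∀ d y c → d + + 2 * (c - + 1) * y ≡ (+ 1 + d) + ((c - + 2) * (+ 2 * y) + (y - + 1) + y)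
    slack = solve-∀

  1≤a-from : ∀ {k} → + 0 ≤ a k → + 1 ≤ D k → + 1 ≤ a (suc k)
  1≤a-from {k} 0≤x 1≤d = subst (+ 1 ≤_) (add-diff (a k) (a (suc k))) (ℤP.+-mono-≤ 0≤x 1≤d)
    where
    add-diff : ∀ x y → x + (y - x) ≡ y
    add-diff = solve-∀

  0≤a×1≤D : ∀ k → + 0 ≤ a k × + 1 ≤ D k
  0≤a×1≤D zero = 0≤a₀ , 1≤D₀
  0≤a×1≤D (suc k) with 0≤a×1≤D k
  ... | 0≤aₖ , 1≤Dₖ = ℤP.≤-trans (0≤+ 1) 1≤aₖ₊₁ , ℤP.≤-trans 1≤Dₖ (ℤP.<⇒≤ (D-increasing-from 1≤aₖ₊₁))
    where
    1≤aₖ₊₁ : + 1 ≤ a (suc k)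
    1≤aₖ₊₁ = 1≤a-from 0≤aₖ 1≤Dₖ

  1≤a : ∀ k → + 1 ≤ a (suc k)
  1≤a k = 1≤a-from (proj₁ (0≤a×1≤D k)) (proj₂ (0≤a×1≤D k))

  1≤D : ∀ k → + 1 ≤ D k
  1≤D k = proj₂ (0≤a×1≤D k)

  D-increasing : ∀ k → D k < D (suc k)
  D-increasing k = D-increasing-from (1≤a k)

  D-mono : ∀ {i j} → i ℕ.≤ j → D i ≤ D j
  D-mono i≤j = mono′ (ℕP.≤⇒≤′ i≤j)
    where
    mono′ : ∀ {i j} → i ℕ.≤′ j → D i ≤ D j
    mono′ ℕ.≤′-refl         = ℤP.≤-refl
    mono′ (ℕ.≤′-step i≤′j) = ℤP.≤-trans (mono′ i≤′j) (ℤP.<⇒≤ (D-increasing _))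

  D-unbounded : ∀ k → + k < D k
  D-unbounded zero    = ℤP.suc[i]≤j⇒i<j (1≤D 0)
  D-unbounded (suc k) = ℤP.≤-<-trans (ℤP.i<j⇒suc[i]≤j (D-unbounded k)) (D-increasing k)

  Δ : ℤ
  Δ = a 1 * a 1 - a 0 * a 2

  cassini-step : ∀ k → a (suc (suc k)) * a (suc (suc k)) - a (suc k) * a (suc (suc (suc k)))
                     ≡ a (suc k) * a (suc k) - a k * a (suc (suc k))
  cassini-step k rewrite a-rec′ (suc k) | a-rec′ k = identity (a k) (a (suc k)) c
    where
    identity : ∀ x y c → let z = + 2 * c * y - x in
      z * z - y * (+ 2 * c * z - y) ≡ y * y - x * z
    identity = solve-∀

  cassini : ∀ k → a (suc k) * a (suc k) - a k * a (suc (suc k)) ≡ Δ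
  cassini zero    = refl
  cassini (suc k) = trans (cassini-step k) (cassini k)

  tailDefect : ℕ → ℤ → ℤ
  tailDefect i = defect (a i) (a (suc i)) (a (suc (suc i)))

  tailDefect-≡ : ∀ i u → tailDefect i u ≡ Δ + u * (D i + D (suc i)) + u * u
  tailDefect-≡ i u = trans (expand (a i) (a (suc i)) (a (suc (suc i))) u)
                           (cong (λ δ → δ + u * (D i + D (suc i)) + u * u) (cassini i))
    where
    expand : ∀ x y z u → (y - x + u) * ((z - y + u) + y) - y * (z - y + u)
                       ≡ (y * y - x * z) + u * ((y - x) + (z - y)) + u * u
    expand = solve-∀

  tailDefect₀-≡ : ∀ u → tailDefect 0 u ≡ defect (a 0) (a 1) (+ 2 * c * a 1 - a 0) u
  tailDefect₀-≡ u = cong (λ z → defect (a 0) (a 1) z u) (a-rec′ 0)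

  D₀+D₁≤ : ∀ i → D 0 + D 1 ≤ D i + D (suc i)
  D₀+D₁≤ i = ℤP.+-mono-≤ (D-mono ℕ.z≤n) (D-mono (ℕ.s≤s ℕ.z≤n))

  tailDefect-antitone : ∀ {u} → u ≤ + 0 → ∀ i → tailDefect i u ≤ tailDefect 0 u
  tailDefect-antitone {u} u≤0 i = begin
    tailDefect i u                    ≡⟨ tailDefect-≡ i u ⟩
    Δ + u * (D i + D (suc i)) + u * u ≤⟨ ℤP.+-monoˡ-≤ (u * u) (ℤP.+-monoʳ-≤ Δ
                                           (ℤP.*-monoˡ-≤-nonPos u {{ℤ.nonPositive u≤0}} (D₀+D₁≤ i))) ⟩
    Δ + u * (D 0 + D 1) + u * u       ≡⟨ tailDefect-≡ 0 u ⟨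
    tailDefect 0 u                    ∎
    where open ℤP.≤-Reasoning

  tailDefect-monotone : ∀ {u} → + 0 ≤ u → ∀ i → tailDefect 0 u ≤ tailDefect i u
  tailDefect-monotone {u} 0≤u i = begin
    tailDefect 0 u                    ≡⟨ tailDefect-≡ 0 u ⟩
    Δ + u * (D 0 + D 1) + u * u       ≤⟨ ℤP.+-monoˡ-≤ (u * u) (ℤP.+-monoʳ-≤ Δ
                                           (ℤP.*-monoˡ-≤-nonNeg u {{ℤ.nonNegative 0≤u}} (D₀+D₁≤ i))) ⟩
    Δ + u * (D i + D (suc i)) + u * u ≡⟨ tailDefect-≡ i u ⟨
    tailDefect i u                    ∎
    where open ℤP.≤-Reasoning

  f : ℕ → ℚ
  f k = recip (a k)

  1≤D+-mono : ∀ {i j u} → i ℕ.≤ j → + 1 ≤ D i + u → + 1 ≤ D j + u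
  1≤D+-mono {u = u} i≤j 1≤p = ℤP.≤-trans 1≤p (ℤP.+-monoˡ-≤ u (D-mono i≤j))

  private
    0<a : ∀ i → + 0 < a (suc i)
    0<a i = ℤP.suc[i]≤j⇒i<j (1≤a i)

    0<D+-suc : ∀ {i u} → + 1 ≤ D i + u → + 0 < D (suc i) + u
    0<D+-suc 1≤p = ℤP.suc[i]≤j⇒i<j (1≤D+-mono (ℕP.n≤1+n _) 1≤p)

    index-shift : ∀ n' j → suc n' ℕ.+ j ≡ suc (j ℕ.+ n')
    index-shift n' j = cong suc (ℕP.+-comm n' j)

  tail-step-≤ : ∀ i {u} → + 1 ≤ D i + u → tailDefect i u ≤ + 0 →
                f (suc i) ℚ.+ recip (D (suc i) + u) ℚ.≤ recip (D i + u)
  tail-step-≤ i 1≤p δ≤0 =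
    recip-+-recip-≤-recip (0<a i) (0<D+-suc 1≤p) (ℤP.suc[i]≤j⇒i<j 1≤p) (ℤP.i-j≤0⇒i≤j δ≤0)

  tail-step-≥ : ∀ i {u} → + 1 ≤ D i + u → + 0 ≤ tailDefect i u →
                recip (D i + u) ℚ.≤ f (suc i) ℚ.+ recip (D (suc i) + u)
  tail-step-≥ i 1≤p 0≤δ =
    recip-≤-recip-+-recip (0<a i) (0<D+-suc 1≤p) (ℤP.suc[i]≤j⇒i<j 1≤p) (ℤP.0≤i-j⇒j≤i 0≤δ)

  tail-step-slack : ∀ i {u} → + 1 ≤ D i + u → + 1 ≤ tailDefect i u →
    recip (D i + u) ℚ.+ recip (a (suc i) * (D (suc i) + u) * (D i + u))
      ℚ.≤ f (suc i) ℚ.+ recip (D (suc i) + u)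
  tail-step-slack i 1≤p 1≤δ =
    recip-+-recip-xyz-≤-recip-+-recip (0<a i) (0<D+-suc 1≤p) (ℤP.suc[i]≤j⇒i<j 1≤p) 1≤δ

  floor-upper : ∀ n' {u} → u ≤ + 0 → + 0 ≤ D n' + u → tailDefect 0 u ≤ + 0 →
                ∀ N → ((D n' + u) / 1) ℚ.* partialSum f (suc n') N ℚ.≤ 1ℚ
  floor-upper n' {u} u≤0 0≤p δ≤0 N with D n' + u ℤ.≟ + 0
  ... | yes p≡0 = subst (λ m → (m / 1) ℚ.* partialSum f (suc n') N ℚ.≤ 1ℚ) (sym p≡0)
                    (subst (ℚ._≤ 1ℚ) (sym (ℚP.*-zeroˡ (partialSum f (suc n') N))) (ℚ.*≤* (+≤+ ℕ.z≤n)))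
  ... | no p≢0  = ≤-recip⇒*≤1 (partialSum f (suc n') N) 0<p (begin
    partialSum f (suc n') N                       ≡⟨ ℚP.+-identityʳ (partialSum f (suc n') N) ⟨
    partialSum f (suc n') N ℚ.+ 0ℚ                ≤⟨ ℚP.+-monoʳ-≤ (partialSum f (suc n') N) (recip-nonNeg (D (suc N ℕ.+ n') + u)) ⟩
    partialSum f (suc n') N ℚ.+ t (suc N)         ≤⟨ telescope-≤ f (suc n') t base step N ⟩
    recip (D n' + u)                              ∎)
    where
    open ℚP.≤-Reasoning
    0<p : + 0 < D n' + u
    0<p = ℤP.≤∧≢⇒< 0≤p (λ 0≡p → p≢0 (sym 0≡p))
    1≤p : ∀ j → + 1 ≤ D (j ℕ.+ n') + u
    1≤p j = 1≤D+-mono (ℕP.m≤n+m n' j) (ℤP.i<j⇒suc[i]≤j 0<p)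
    t : ℕ → ℚ
    t j = recip (D (j ℕ.+ n') + u)
    base : f (suc n') ℚ.+ t 1 ℚ.≤ recip (D n' + u)
    base = tail-step-≤ n' (1≤p 0) (ℤP.≤-trans (tailDefect-antitone u≤0 n') δ≤0)
    step : ∀ j → f (suc n' ℕ.+ suc j) ℚ.+ t (suc (suc j)) ℚ.≤ t (suc j)
    step j = subst (λ k → recip (a k) ℚ.+ t (suc (suc j)) ℚ.≤ t (suc j)) (sym (index-shift n' (suc j)))
               (tail-step-≤ (suc j ℕ.+ n') (1≤p (suc j))
                 (ℤP.≤-trans (tailDefect-antitone u≤0 (suc j ℕ.+ n')) δ≤0))

  floor-lower : ∀ n' {u} → + 0 ≤ u → + 1 ≤ tailDefect 0 u →
                ∃[ N ] 1ℚ ℚ.< ((D n' + u) / 1) ℚ.* partialSum f (suc n') N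
  floor-lower n' {u} 0≤u 1≤δ₀ =
    N , recip<⇒1<* (partialSum f (suc n') N) (ℤP.suc[i]≤j⇒i<j (1≤p 0)) (+-cancelʳ-< (recip w) gain)
    where
    1≤δ : ∀ i → + 1 ≤ tailDefect i u
    1≤δ i = ℤP.≤-trans 1≤δ₀ (tailDefect-monotone 0≤u i)
    1≤p : ∀ j → + 1 ≤ D (j ℕ.+ n') + u
    1≤p j = ℤP.≤-trans (1≤D (j ℕ.+ n')) (ℤP.i≤i+j (D (j ℕ.+ n')) u {{ℤ.nonNegative 0≤u}})
    t : ℕ → ℚ
    t j = recip (D (j ℕ.+ n') + u)
    w : ℤ
    w = a (suc n') * (D (suc n') + u) * (D n' + u)
    1≤w : + 1 ≤ w
    1≤w = 1≤i*j (1≤i*j (1≤a n') (1≤p 1)) (1≤p 0)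
    -- Past index N = ∣w∣ the remainder 1/p is below the slack 1/w gained at the first step.
    N : ℕ
    N = ∣ w ∣
    w<p : w < D (suc N ℕ.+ n') + u
    w<p = begin-strict
      w                          ≡⟨ ℤP.0≤i⇒+∣i∣≡i (ℤP.≤-trans (0≤+ 1) 1≤w) ⟨
      + N                        ≤⟨ +≤+ (ℕP.m≤n⇒m≤1+n (ℕP.m≤m+n N n')) ⟩
      + (suc N ℕ.+ n')           <⟨ D-unbounded (suc N ℕ.+ n') ⟩
      D (suc N ℕ.+ n')           ≤⟨ ℤP.i≤i+j (D (suc N ℕ.+ n')) u {{ℤ.nonNegative 0≤u}} ⟩
      D (suc N ℕ.+ n') + u       ∎
      where open ℤP.≤-Reasoning
    base : recip (D n' + u) ℚ.+ recip w ℚ.≤ f (suc n') ℚ.+ t 1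
    base = tail-step-slack n' (1≤p 0) (1≤δ n')
    step : ∀ j → t (suc j) ℚ.≤ f (suc n' ℕ.+ suc j) ℚ.+ t (suc (suc j))
    step j = subst (λ k → t (suc j) ℚ.≤ recip (a k) ℚ.+ t (suc (suc j))) (sym (index-shift n' (suc j)))
               (tail-step-≥ (suc j ℕ.+ n') (1≤p (suc j)) (ℤP.≤-trans (0≤+ 1) (1≤δ (suc j ℕ.+ n'))))
    gain : recip (D n' + u) ℚ.+ recip w ℚ.< partialSum f (suc n') N ℚ.+ recip w
    gain = begin-strict
      recip (D n' + u) ℚ.+ recip w          ≤⟨ telescope-≥ f (suc n') t base step N ⟩
      partialSum f (suc n') N ℚ.+ t (suc N) <⟨ ℚP.+-monoʳ-< (partialSum f (suc n') N)
                                                 (recip-antitone-< (ℤP.suc[i]≤j⇒i<j 1≤w) w<p) ⟩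
      partialSum f (suc n') N ℚ.+ recip w   ∎
      where open ℚP.≤-Reasoning

  floorInvTail : ∀ n' {m} u v → m ≡ D n' + u → m + + 1 ≡ D n' + v →
                 u ≤ + 0 → + 0 ≤ m → tailDefect 0 u ≤ + 0 →
                 + 0 ≤ v → + 1 ≤ tailDefect 0 v →
                 FloorInvTail f (suc n') m
  floorInvTail n' u v refl m+1≡ u≤0 0≤m δᵤ≤0 0≤v 1≤δᵥ =
    floor-upper n' u≤0 0≤m δᵤ≤0 ,
    subst (λ m+1 → ∃[ N ] 1ℚ ℚ.< (m+1 / 1) ℚ.* partialSum f (suc n') N) (sym m+1≡)
      (floor-lower n' 0≤v 1≤δᵥ)

-- The balancing recurrence and its multisections

Recurrent : (ℕ → ℤ) → Set
Recurrent X = ∀ n → X (suc (suc n)) + X n ≡ + 6 * X (suc n)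

-- Induction on j for all solutions at once: the cases j and j + 1 are used for
-- the shifts X ∘ suc ∘ suc and X ∘ suc, mirroring C (j + 2) = 6 C (j + 1) − C j.
recurrent-double : ∀ j X → Recurrent X → X (j ℕ.+ j) + X 0 ≡ + 2 * C j * X j
recurrent-double zero X _ = double (X 0)
  where
  double : ∀ x → x + x ≡ + 2 * + 1 * x
  double = solve-∀
recurrent-double (suc zero) X rec = rec 0
recurrent-double (suc (suc j)) X rec = begin
  X (suc (suc j) ℕ.+ suc (suc j)) + X 0
    ≡⟨ cong (λ i → X i + X 0) (cong (suc ∘ suc) (ℕP.+-suc j (suc j))) ⟩
  X (suc (suc (suc (j ℕ.+ suc j)))) + X 0
    ≡⟨ combine (X (3 ℕ.+ k′)) (X (2 ℕ.+ k′)) (X (1 ℕ.+ k′)) (X 2) (X 1) (X 0) (rec (suc k′)) (rec 0) ⟩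
  + 6 * (X (suc (suc j ℕ.+ suc j)) + X 1) - (X (suc (j ℕ.+ suc j)) + X 2)
    ≡⟨ cong₂ (λ s t → + 6 * s - t) (recurrent-double (suc j) (X ∘ suc) (rec ∘ suc))
              (trans (cong (λ i → X (suc i) + X 2) (ℕP.+-suc j j))
                     (recurrent-double j (X ∘ suc ∘ suc) (rec ∘ suc ∘ suc))) ⟩
  + 6 * (+ 2 * C (suc j) * X (suc (suc j))) - + 2 * C j * X (suc (suc j))
    ≡⟨ collect (C (suc j)) (C j) (X (suc (suc j))) ⟩
  + 2 * C (suc (suc j)) * X (suc (suc j)) ∎
  where
  open ≡-Reasoning
  k′ : ℕ
  k′ = j ℕ.+ suc j
  combine : ∀ x₄ x₃ x₂ y₂ y₁ y₀ → x₄ + x₂ ≡ + 6 * x₃ → y₂ + y₀ ≡ + 6 * y₁ →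
            x₄ + y₀ ≡ + 6 * (x₃ + y₁) - (x₂ + y₂)
  combine x₄ x₃ x₂ y₂ y₁ y₀ e₁ e₂ =
    trans (shuffle x₄ x₂ y₂ y₀) (trans (cong₂ (λ s t → s + t - (x₂ + y₂)) e₁ e₂) (factor x₃ y₁ x₂ y₂))
    where
    shuffle : ∀ x₄ x₂ y₂ y₀ → x₄ + y₀ ≡ (x₄ + x₂) + (y₂ + y₀) - (x₂ + y₂)
    shuffle = solve-∀
    factor : ∀ x₃ y₁ x₂ y₂ → + 6 * x₃ + + 6 * y₁ - (x₂ + y₂) ≡ + 6 * (x₃ + y₁) - (x₂ + y₂)
    factor = solve-∀
  collect : ∀ c₁ c₀ x → + 6 * (+ 2 * c₁ * x) - + 2 * c₀ * x ≡ + 2 * (+ 6 * c₁ - c₀) * x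
  collect = solve-∀

multisection : ∀ X → Recurrent X → ∀ l k →
               X (l ℕ.* suc (suc k)) + X (l ℕ.* k) ≡ + 2 * C l * X (l ℕ.* suc k)
multisection X rec l k =
  subst₂ (λ i j → X i + X (l ℕ.* k) ≡ + 2 * C l * X j) (sym l*[2+k]) (sym (ℕP.*-suc l k))
    (recurrent-double l (λ n → X (n ℕ.+ l ℕ.* k)) (λ n → rec (n ℕ.+ l ℕ.* k)))
  where
  l*[2+k] : l ℕ.* suc (suc k) ≡ l ℕ.+ l ℕ.+ l ℕ.* k
  l*[2+k] = trans (ℕP.*-suc l (suc k)) (trans (cong (l ℕ.+_) (ℕP.*-suc l k)) (sym (ℕP.+-assoc l l (l ℕ.* k))))

recurrent-sub : ∀ X Y → Recurrent X → Recurrent Y → Recurrent (λ n → X n - Y n)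
recurrent-sub X Y recX recY n =
  trans (regroup (X (suc (suc n))) (X n) (Y (suc (suc n))) (Y n))
        (trans (cong₂ _-_ (recX n) (recY n)) (factor (X (suc n)) (Y (suc n))))
  where
  regroup : ∀ x₂ x₀ y₂ y₀ → (x₂ - y₂) + (x₀ - y₀) ≡ (x₂ + x₀) - (y₂ + y₀)
  regroup = solve-∀
  factor : ∀ x y → + 6 * x - + 6 * y ≡ + 6 * (x - y)
  factor = solve-∀

private
  sub-add : ∀ x y → x - y + y ≡ x
  sub-add = solve-∀

B-recurrent : Recurrent B
B-recurrent n = sub-add (+ 6 * B (suc n)) (B n)

C-recurrent : Recurrent C
C-recurrent n = sub-add (+ 6 * C (suc n)) (C n)

C-B : ℕ → ℤ
C-B n = C n - B n

C-B-recurrent : Recurrent C-B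
C-B-recurrent = recurrent-sub C B C-recurrent B-recurrent

private
  2≤3 : + 2 ≤ + 3
  2≤3 = +≤+ (ℕ.s≤s (ℕ.s≤s ℕ.z≤n))

  module B-seq = SecondOrder B (+ 3) 2≤3 B-recurrent ℤP.≤-refl ℤP.≤-refl
  module C-B-seq = SecondOrder C-B (+ 3) 2≤3 C-B-recurrent (0≤+ 1) ℤP.≤-refl

1≤B : ∀ n → + 1 ≤ B (suc n)
1≤B = B-seq.1≤a

B+1≤C : ∀ n → B (suc n) + + 1 ≤ C (suc n)
B+1≤C n = subst (B (suc n) + + 1 ≤_) (add-diff (B (suc n)) (C (suc n)))
                (ℤP.+-monoʳ-≤ (B (suc n)) (C-B-seq.1≤a n))
  where
  add-diff : ∀ b c → b + (c - b) ≡ c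
  add-diff = solve-∀

2≤C : ∀ n → + 2 ≤ C (suc n)
2≤C n = ℤP.≤-trans (ℤP.+-monoˡ-≤ (+ 1) (1≤B n)) (B+1≤C n)

balancing-tail : ∀ l' n' →
  FloorInvTail (λ k → recip (B (suc l' ℕ.* k))) (suc n') (B (suc l' ℕ.* suc n') - B (suc l' ℕ.* n') - + 1)
balancing-tail l' n' =
  floorInvTail n' (- + 1) (+ 0) refl (sub-add-0 (D n')) ℤ.-≤+ (ℤP.i≤j⇒0≤j-i (1≤D n'))
    δ₋₁≤0 ℤP.≤-refl 1≤δ₀
  where
  l : ℕ
  l = suc l'
  b c : ℤ
  b = B l
  c = C l
  a : ℕ → ℤ
  a k = B (l ℕ.* k)
  a₀≡ : a 0 ≡ + 0
  a₀≡ = cong B (ℕP.*-zeroʳ l)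
  a₁≡ : a 1 ≡ b
  a₁≡ = cong B (ℕP.*-identityʳ l)
  0≤a₀ : + 0 ≤ a 0
  0≤a₀ = subst (+ 0 ≤_) (sym a₀≡) ℤP.≤-refl
  1≤D₀ : + 1 ≤ a 1 - a 0
  1≤D₀ = subst₂ (λ x y → + 1 ≤ y - x) (sym a₀≡) (sym a₁≡)
                (subst (+ 1 ≤_) (sym (ℤP.+-identityʳ b)) (1≤B l'))
  open SecondOrder a c (2≤C l') (multisection B B-recurrent l) 0≤a₀ 1≤D₀
  sub-add-0 : ∀ d → d - + 1 + + 1 ≡ d + + 0
  sub-add-0 = solve-∀
  δ₀≡ : ∀ u → tailDefect 0 u ≡ defect (+ 0) b (+ 2 * c * b - + 0) u
  δ₀≡ u = trans (tailDefect₀-≡ u) (cong₂ (λ x y → defect x y (+ 2 * c * y - x) u) a₀≡ a₁≡)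
  1≤2c-b : + 1 ≤ + 2 * c - b
  1≤2c-b = ≤-via-slack (ℤP.+-mono-≤ (ℤP.+-mono-≤ (0≤i*j (0≤+ 2) (ℤP.i≤j⇒0≤j-i (B+1≤C l')))
                                                  (ℤP.i≤j⇒0≤j-i (1≤B l'))) (0≤+ 2))
                       (slack b c)
    where
    slack : ∀ b c → + 2 * c - b ≡ + 1 + (+ 2 * (c - (b + + 1)) + (b - + 1) + + 2)
    slack = solve-∀
  δ₋₁≤0 : tailDefect 0 (- + 1) ≤ + 0
  δ₋₁≤0 = subst (_≤ + 0) (sym (trans (δ₀≡ (- + 1)) (value b c)))
                (ℤP.i≤j⇒i-j≤0 (1≤i*j (1≤B l') 1≤2c-b))
    where
    value : ∀ b c → (b - + 0 + - + 1) * ((+ 2 * c * b - + 0 - b + - + 1) + b) - b * (+ 2 * c * b - + 0 - b + - + 1)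
                  ≡ + 1 - b * (+ 2 * c - b)
    value = solve-∀
  1≤δ₀ : + 1 ≤ tailDefect 0 (+ 0)
  1≤δ₀ = subst (+ 1 ≤_) (sym (trans (δ₀≡ (+ 0)) (value b c))) (1≤i*j (1≤B l') (1≤B l'))
    where
    value : ∀ b c → (b - + 0 + + 0) * ((+ 2 * c * b - + 0 - b + + 0) + b) - b * (+ 2 * c * b - + 0 - b + + 0)
                  ≡ b * b
    value = solve-∀

lucas-balancing-tail : ∀ l' n' →
  FloorInvTail (λ k → recip (C (suc l' ℕ.* k))) (suc n') (C (suc l' ℕ.* suc n') - C (suc l' ℕ.* n'))
lucas-balancing-tail l' n' =
  floorInvTail n' (+ 0) (+ 1) (sym (ℤP.+-identityʳ (D n'))) refl ℤP.≤-refl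
    (ℤP.≤-trans (0≤+ 1) (1≤D n')) δ₀≤0 (0≤+ 1) 1≤δ₁
  where
  l : ℕ
  l = suc l'
  c : ℤ
  c = C l
  a : ℕ → ℤ
  a k = C (l ℕ.* k)
  a₀≡ : a 0 ≡ + 1
  a₀≡ = cong C (ℕP.*-zeroʳ l)
  a₁≡ : a 1 ≡ c
  a₁≡ = cong C (ℕP.*-identityʳ l)
  0≤a₀ : + 0 ≤ a 0
  0≤a₀ = subst (+ 0 ≤_) (sym a₀≡) (0≤+ 1)
  1≤D₀ : + 1 ≤ a 1 - a 0
  1≤D₀ = subst₂ (λ x y → + 1 ≤ y - x) (sym a₀≡) (sym a₁≡) (ℤP.+-monoˡ-≤ (- + 1) (2≤C l'))
  open SecondOrder a c (2≤C l') (multisection C C-recurrent l) 0≤a₀ 1≤D₀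
  δ₀≡ : ∀ u → tailDefect 0 u ≡ defect (+ 1) c (+ 2 * c * c - + 1) u
  δ₀≡ u = trans (tailDefect₀-≡ u) (cong₂ (λ x y → defect x y (+ 2 * c * y - x) u) a₀≡ a₁≡)
  1≤c² : + 1 ≤ c * c
  1≤c² = 1≤i*j 1≤c 1≤c
    where
    1≤c : + 1 ≤ c
    1≤c = ℤP.≤-trans (+≤+ (ℕ.s≤s ℕ.z≤n)) (2≤C l')
  δ₀≤0 : tailDefect 0 (+ 0) ≤ + 0
  δ₀≤0 = subst (_≤ + 0) (sym (trans (δ₀≡ (+ 0)) (value c))) (ℤP.i≤j⇒i-j≤0 1≤c²)
    where
    value : ∀ c → (c - + 1 + + 0) * ((+ 2 * c * c - + 1 - c + + 0) + c) - c * (+ 2 * c * c - + 1 - c + + 0)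
                ≡ + 1 - c * c
    value = solve-∀
  1≤δ₁ : + 1 ≤ tailDefect 0 (+ 1)
  1≤δ₁ = subst (+ 1 ≤_) (sym (trans (δ₀≡ (+ 1)) (value c))) 1≤c²
    where
    value : ∀ c → (c - + 1 + + 1) * ((+ 2 * c * c - + 1 - c + + 1) + c) - c * (+ 2 * c * c - + 1 - c + + 1)
                ≡ c * c
    value = solve-∀

theorem4 : (l : ℕ) → l ℕ.≥ 1 → (n : ℕ) → n ℕ.≥ 1 →
    FloorInvTail (λ k → recip (B (l ℕ.* k))) n (B (l ℕ.* n) ℤ.- B (l ℕ.* (n ℕ.∸ 1)) ℤ.- + 1)
    × FloorInvTail (λ k → recip (C (l ℕ.* k))) n (C (l ℕ.* n) ℤ.- C (l ℕ.* (n ℕ.∸ 1)))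
theorem4 (suc l') _ (suc n') _ = balancing-tail l' n' , lucas-balancing-tail l' n'
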